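{- For every integer $n\ge 4$ there exists a Steiner triple system of order $v=2^n-7$ having a maximal independent set of cardinality $\frac{v-1}{2}$.
   Context: A Steiner triple system of order $v$ is a pair $(X,\mathcal B)$ with $|X|=v$ and $\mathcal B$ a family of $3$-subsets of $X$ (blocks) such that every $2$-subset of $X$ lies in exactly one block. An independent set is a subset of $X$ containing no block; it is maximal if it is not properly contained in another independent set. For $v\equiv 1,9\pmod{12}$, $\frac{v-1}{2}$ is the largest possible cardinality of a maximal independent set. -}

module Defs where

open import Data.Nat using (ℕ; _∸_; _^_; _<_)
open import Data.Fin using (Fin; toℕ)
open import Data.Fin.Subset using (Subset; _∈_; _⊂_; ∣_∣)
open import Data.List using (List; length; filter)
open import Data.List.Membership.Propositional renaming (_∈_ to _∈ₗ_)
open import Data.Product using (_×_; _,_; Σ)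
open import Relation.Nullary using (¬_)
open import Relation.Binary.PropositionalEquality using (_≡_)
open import Relation.Unary using (Decidable)
open import Data.Fin.Properties using (_≟_)
open import Relation.Nullary.Decidable using (_⊎-dec_; _×-dec_)
open import Data.Sum using (_⊎_)

-- A block on the point set Fin v: a 3-subset {a,b,c}, stored canonically
-- as a strictly increasing triple a < b < c.
record Block (v : ℕ) : Set where
  constructor blk
  field
    a b c : Fin v
    a<b : toℕ a < toℕ b
    b<c : toℕ b < toℕ c
open Block public

_∈B_ : {v : ℕ} → Fin v → Block v → Set
x ∈B B = (x ≡ a B) ⊎ (x ≡ b B) ⊎ (x ≡ c B)

_∈B?_ : {v : ℕ} → (x : Fin v) → (B : Block v) → Relation.Nullary.Dec (x ∈B B)
x ∈B? B = (x ≟ a B) ⊎-dec ((x ≟ b B) ⊎-dec (x ≟ c B))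

pairCount : {v : ℕ} → List (Block v) → Fin v → Fin v → ℕ
pairCount 𝓑 x y = length (filter (λ B → (x ∈B? B) ×-dec (y ∈B? B)) 𝓑)

IsSTS : (v : ℕ) → List (Block v) → Set
IsSTS v 𝓑 = (x y : Fin v) → ¬ (x ≡ y) → pairCount 𝓑 x y ≡ 1

_⊆S_ : {v : ℕ} → Block v → Subset v → Set
B ⊆S S = (a B ∈ S) × (b B ∈ S) × (c B ∈ S)

Independent : {v : ℕ} → List (Block v) → Subset v → Set
Independent 𝓑 S = (B : Block _) → B ∈ₗ 𝓑 → ¬ (B ⊆S S)

MaximalIndependent : {v : ℕ} → List (Block v) → Subset v → Set
MaximalIndependent 𝓑 S =
  Independent 𝓑 S × ((T : Subset _) → S ⊂ T → ¬ Independent 𝓑 T)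

-- A Steiner triple system is the same thing as a Steiner quasigroup (x·x = x, x·y = y·x,
-- x·(x·y) = y) with blocks {x, y, x·y}; a set S is independent when x·y ∉ S for distinct
-- x, y ∈ S, and maximal when every point outside S is such a product.
-- Write v = 2ⁿ − 7 = 1 + 8(2ᵏ − 1) with k = n − 3, and take as points ∞ together with the
-- pairs (r, h), r ∈ 𝔽₂³, 0 ≠ h ∈ 𝔽₂ᵏ. Each fibre {∞} ∪ 𝔽₂³ × {h} carries a copy of the
-- affine plane AG(2,3) with ∞ at the origin, and points in different fibres multiply by
-- coordinatewise addition. The points whose r has first bit 1 form a complete cap in every
-- fibre, and two of them in different fibres sum to a point with first bit 0, so they form a
-- maximal independent set; there are 4(2ᵏ − 1) = (v − 1)/2 of them.
module Submission where

open import Defs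
open import Data.Bool using (Bool; true; false; not; _xor_)
open import Data.Bool.Properties using (¬-not; xor-same; xor-assoc; xor-comm; xor-identityʳ)
  renaming (_≟_ to _≟ᵇ_)
open import Data.Empty using (⊥-elim)
open import Data.Fin as Fin using (Fin; toℕ; fromℕ<)
open import Data.Fin.Patterns using (0F; 1F; 2F)
open import Data.Fin.Properties using (<-cmp; <⇒≢; _<?_; toℕ-injective; toℕ-fromℕ<; toℕ<n)
open import Data.Fin.Subset using (Subset; _∈_; _⊂_; ∣_∣)
open import Data.List using (List; []; _∷_; length; filter; mapMaybe; cartesianProduct; allFin)
open import Data.List.Membership.Propositional using () renaming (_∈_ to _∈ₗ_)
open import Data.List.Membership.Propositional.Properties using (∈-allFin; ∈-cartesianProduct⁺)
open import Data.List.Properties using (filter-none)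
open import Data.List.Relation.Unary.All as All using ()
open import Data.List.Relation.Unary.Any using (here; there)
open import Data.List.Relation.Unary.Unique.Propositional using (Unique; _∷_)
open import Data.List.Relation.Unary.Unique.Propositional.Properties using (allFin⁺; cartesianProduct⁺)
open import Data.Maybe as Maybe using (Maybe; just; nothing)
open import Data.Maybe.Properties using (just-injective)
open import Data.Maybe.Relation.Unary.All using (All; just; nothing)
open import Data.Maybe.Relation.Unary.Any as MaybeAny using (just)
open import Data.Nat using (ℕ; zero; suc; _+_; _*_; _^_; _∸_; _<_; _≤_; z≤n; s≤s; ⌊_/2⌋; pred)
open import Data.Nat.Properties
  using ( ≤-refl; ≤-trans; ≤-antisym; <-trans; <⇒≤; <⇒≱; ≤-<-trans; ≤-pred; n<1+n; m≤m+n; m≤n+m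
        ; +-identityʳ; *-zeroʳ; +-monoˡ-≤; +-monoʳ-<; *-monoʳ-≤; *-cancelˡ-<; ∸-monoˡ-≤
        ; m+[n∸m]≡n; m+n≡0⇒m≡0; <-irrelevant; suc-pred; m^n≢0; module ≤-Reasoning )
open import Data.Nat.Tactic.RingSolver using (solve-∀)
open import Data.Product using (Σ; ∃; ∃₂; _×_; _,_; proj₁; proj₂; uncurry)
open import Data.Sum using (_⊎_; inj₁; inj₂; [_,_]; swap)
open import Data.Unit using (⊤; tt)
open import Data.Vec using (Vec; []; _∷_; _++_; zipWith; replicate; tabulate)
open import Data.Vec.Properties using (zipWith-comm; zipWith-identityʳ; ≡-dec; lookup∘tabulate; []=⇒lookup; lookup⇒[]=)
open import Function using (_∘_)
open import Function.Bundles using (_⇔_; mk⇔; Equivalence)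
open import Relation.Binary.Definitions using (tri<; tri≈; tri>)
open import Relation.Binary.PropositionalEquality
  using (_≡_; _≢_; refl; sym; trans; cong; cong₂; subst; module ≡-Reasoning)
open import Relation.Nullary using (¬_; Dec; yes; no)
open import Relation.Nullary.Decidable using (_×-dec_)

private
  variable
    A B : Set

module _ (f : A → Maybe B) where

  ∈-mapMaybe⁺ : ∀ {xs x y} → x ∈ₗ xs → f x ≡ just y → y ∈ₗ mapMaybe f xs
  ∈-mapMaybe⁺ {x ∷ xs} (here refl) fx≡y with f x
  ... | just _ = here (sym (just-injective fx≡y))
  ∈-mapMaybe⁺ {x ∷ xs} (there x∈xs) fx≡y with f x
  ... | just _  = there (∈-mapMaybe⁺ x∈xs fx≡y)
  ... | nothing = ∈-mapMaybe⁺ x∈xs fx≡y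

  ∈-mapMaybe⁻ : ∀ xs {y} → y ∈ₗ mapMaybe f xs → ∃ λ x → f x ≡ just y
  ∈-mapMaybe⁻ (x ∷ xs) y∈ with f x in eq
  ... | nothing = ∈-mapMaybe⁻ xs y∈
  ∈-mapMaybe⁻ (x ∷ xs) (here refl) | just _ = x , eq
  ∈-mapMaybe⁻ (x ∷ xs) (there y∈)  | just _ = ∈-mapMaybe⁻ xs y∈

  length-filter-mapMaybe : ∀ {P : B → Set} (P? : ∀ y → Dec (P y)) xs →
    length (filter P? (mapMaybe f xs)) ≡ length (filter (MaybeAny.dec P? ∘ f) xs)
  length-filter-mapMaybe P? []       = refl
  length-filter-mapMaybe P? (x ∷ xs) with f x
  ... | nothing = length-filter-mapMaybe P? xs
  ... | just y with P? y
  ...   | yes _ = cong suc (length-filter-mapMaybe P? xs)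
  ...   | no _  = length-filter-mapMaybe P? xs

length-filter-unique : ∀ {P : A → Set} (P? : ∀ x → Dec (P x)) {xs x} →
  Unique xs → x ∈ₗ xs → P x → (∀ {y} → P y → y ≡ x) → length (filter P? xs) ≡ 1
length-filter-unique P? {y ∷ ys} (y∉ys ∷ unique) x∈ Px only-x with P? y
... | yes Py = cong (suc ∘ length)
  (filter-none P? (All.map (λ y≢z Pz → y≢z (trans (only-x Py) (sym (only-x Pz)))) y∉ys))
... | no ¬Py with x∈
...   | here refl  = ⊥-elim (¬Py Px)
...   | there x∈ys = length-filter-unique P? unique x∈ys Px only-x

∈-tabulate : ∀ {n} {σ : Fin n → Bool} {i} → i ∈ tabulate σ ⇔ σ i ≡ true
∈-tabulate {σ = σ} {i} = mk⇔ (λ i∈ → trans (sym (lookup∘tabulate σ i)) ([]=⇒lookup i∈))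
                             (λ σi → lookup⇒[]= i _ (trans (lookup∘tabulate σ i) σi))

module _ {A : Set} where

  _∈³_ : A → A × A × A → Set
  x ∈³ (p , q , r) = x ≡ p ⊎ x ≡ q ⊎ x ≡ r

  _≐_ : A × A × A → A × A × A → Set
  t ≐ u = ∀ {x} → x ∈³ t ⇔ x ∈³ u

  ≐-refl : ∀ {t} → t ≐ t
  ≐-refl = mk⇔ (λ x∈ → x∈) (λ x∈ → x∈)

  ≐-sym : ∀ {t u} → t ≐ u → u ≐ t
  ≐-sym t≐u = mk⇔ (Equivalence.from t≐u) (Equivalence.to t≐u)

  ≐-trans : ∀ {t u w} → t ≐ u → u ≐ w → t ≐ w
  ≐-trans t≐u u≐w = mk⇔ (Equivalence.to u≐w ∘ Equivalence.to t≐u) (Equivalence.from t≐u ∘ Equivalence.from u≐w)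

  ≐-swap₁₂ : ∀ {p q r} → (p , q , r) ≐ (q , p , r)
  ≐-swap₁₂ = mk⇔ swap₁₂ swap₁₂
    where swap₁₂ : ∀ {x p q r} → x ∈³ (p , q , r) → x ∈³ (q , p , r)
          swap₁₂ = [ inj₂ ∘ inj₁ , [ inj₁ , inj₂ ∘ inj₂ ] ]

  ≐-swap₂₃ : ∀ {p q r} → (p , q , r) ≐ (p , r , q)
  ≐-swap₂₃ = mk⇔ swap₂₃ swap₂₃
    where swap₂₃ : ∀ {x p q r} → x ∈³ (p , q , r) → x ∈³ (p , r , q)
          swap₂₃ = [ inj₁ , inj₂ ∘ swap ]

  ≐-third : ∀ {p q r r′} → r ≡ r′ → (p , q , r) ≐ (p , q , r′)
  ≐-third refl = ≐-refl

module _ {v : ℕ} {a b c z : Fin v} (a<b : toℕ a < toℕ b) (b<c : toℕ b < toℕ c) where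

  ∈³-sorted⇒min≤ : z ∈³ (a , b , c) → toℕ a ≤ toℕ z
  ∈³-sorted⇒min≤ (inj₁ refl)        = ≤-refl
  ∈³-sorted⇒min≤ (inj₂ (inj₁ refl)) = <⇒≤ a<b
  ∈³-sorted⇒min≤ (inj₂ (inj₂ refl)) = <⇒≤ (<-trans a<b b<c)

  ∈³-sorted⇒≤max : z ∈³ (a , b , c) → toℕ z ≤ toℕ c
  ∈³-sorted⇒≤max (inj₁ refl)        = <⇒≤ (<-trans a<b b<c)
  ∈³-sorted⇒≤max (inj₂ (inj₁ refl)) = <⇒≤ b<c
  ∈³-sorted⇒≤max (inj₂ (inj₂ refl)) = ≤-refl

≐-sorted⇒≡ : ∀ {v} {a b c a′ b′ c′ : Fin v} →
  toℕ a < toℕ b → toℕ b < toℕ c → toℕ a′ < toℕ b′ → toℕ b′ < toℕ c′ →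
  (a , b , c) ≐ (a′ , b′ , c′) → a ≡ a′ × b ≡ b′
≐-sorted⇒≡ a<b b<c a′<b′ b′<c′ t≐t′ = a≡a′ , b≡b′
  where
  open Equivalence
  a≡a′ = toℕ-injective (≤-antisym (∈³-sorted⇒min≤ a<b b<c (from t≐t′ (inj₁ refl)))
                                  (∈³-sorted⇒min≤ a′<b′ b′<c′ (to t≐t′ (inj₁ refl))))
  c≡c′ = toℕ-injective (≤-antisym (∈³-sorted⇒≤max a′<b′ b′<c′ (to t≐t′ (inj₂ (inj₂ refl))))
                                  (∈³-sorted⇒≤max a<b b<c (from t≐t′ (inj₂ (inj₂ refl)))))
  b≡b′ = [ (λ b≡a′ → ⊥-elim (<⇒≢ a<b (trans a≡a′ (sym b≡a′))))
         , [ (λ b≡b′ → b≡b′) , (λ b≡c′ → ⊥-elim (<⇒≢ b<c (trans b≡c′ (sym c≡c′)))) ] ]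
         (to t≐t′ (inj₂ (inj₁ refl)))

record IsSteinerQuasigroupOn {A : Set} (V : A → Set) (_·_ : A → A → A) : Set where
  field
    closed : ∀ {x y} → V x → V y → V (x · y)
    idem   : ∀ {x} → V x → x · x ≡ x
    comm   : ∀ {x y} → V x → V y → x · y ≡ y · x
    cancel : ∀ {x y} → V x → V y → x · (x · y) ≡ y

record IsSteinerQuasigroup {A : Set} (_·_ : A → A → A) : Set where
  field
    idem   : ∀ x → x · x ≡ x
    comm   : ∀ x y → x · y ≡ y · x
    cancel : ∀ x y → x · (x · y) ≡ y

  isSteinerQuasigroupOn : IsSteinerQuasigroupOn (λ _ → ⊤) _·_
  isSteinerQuasigroupOn = record
    { closed = λ _ _ → tt ; idem = λ {x} _ → idem x ; comm = λ {x} {y} _ _ → comm x y ; cancel = λ {x} {y} _ _ → cancel x y }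

  cancel′ : ∀ x y → (x · y) · x ≡ y
  cancel′ x y = trans (comm (x · y) x) (cancel x y)

  absorb : ∀ x y → y · (x · y) ≡ x
  absorb x y = trans (cong (y ·_) (comm x y)) (cancel y x)

  absorb′ : ∀ x y → (x · y) · y ≡ x
  absorb′ x y = trans (comm (x · y) y) (absorb x y)

  ·-≢ˡ : ∀ {x y} → x ≢ y → x · y ≢ x
  ·-≢ˡ {x} {y} x≢y xy≡x = x≢y (sym (trans (sym (cancel x y)) (trans (cong (x ·_) xy≡x) (idem x))))

  ·-≢ʳ : ∀ {x y} → x ≢ y → x · y ≢ y
  ·-≢ʳ {x} {y} x≢y xy≡y = ·-≢ˡ (x≢y ∘ sym) (trans (comm y x) xy≡y)

  line : A → A → A × A × A
  line a b = a , b , a · b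

  line-≐ : ∀ {a b x y} → x ∈³ line a b → y ∈³ line a b → x ≢ y → line x y ≐ line a b
  line-≐ (inj₁ refl)        (inj₁ refl)        x≢y = ⊥-elim (x≢y refl)
  line-≐ (inj₂ (inj₁ refl)) (inj₂ (inj₁ refl)) x≢y = ⊥-elim (x≢y refl)
  line-≐ (inj₂ (inj₂ refl)) (inj₂ (inj₂ refl)) x≢y = ⊥-elim (x≢y refl)
  line-≐ (inj₁ refl)        (inj₂ (inj₁ refl)) _   = ≐-refl
  line-≐ (inj₂ (inj₁ refl)) (inj₁ refl)        _   = ≐-trans (≐-third (comm _ _)) ≐-swap₁₂
  line-≐ (inj₁ refl)        (inj₂ (inj₂ refl)) _   = ≐-trans (≐-third (cancel _ _)) ≐-swap₂₃
  line-≐ (inj₂ (inj₂ refl)) (inj₁ refl)        _   =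
    ≐-trans (≐-third (cancel′ _ _)) (≐-trans ≐-swap₁₂ ≐-swap₂₃)
  line-≐ (inj₂ (inj₁ refl)) (inj₂ (inj₂ refl)) _   =
    ≐-trans (≐-third (absorb _ _)) (≐-trans ≐-swap₂₃ ≐-swap₁₂)
  line-≐ (inj₂ (inj₂ refl)) (inj₂ (inj₁ refl)) _   =
    ≐-trans (≐-third (absorb′ _ _)) (≐-trans ≐-swap₁₂ (≐-trans ≐-swap₂₃ ≐-swap₁₂))

record IsCompleteCap {A : Set} (V : A → Set) (_·_ : A → A → A) (σ : A → Bool) : Set where
  field
    cap      : ∀ {x y} → V x → V y → x ≢ y → σ x ≡ true → σ y ≡ true → σ (x · y) ≡ false
    complete : ∀ {z} → V z → σ z ≡ false →
               ∃₂ λ x y → V x × V y × x ≢ y × σ x ≡ true × σ y ≡ true × x · y ≡ z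

module SteinerTripleSystem {v : ℕ} {_·_ : Fin v → Fin v → Fin v} (sq : IsSteinerQuasigroup _·_) where
  open IsSteinerQuasigroup sq

  record SortedLine (x y : Fin v) : Set where
    constructor sortedLine
    field
      low middle   : Fin v
      low<middle   : toℕ low < toℕ middle
      middle<third : toℕ middle < toℕ (low · middle)
      ≐xy          : line low middle ≐ line x y

  sortLine< : ∀ {x y} → toℕ x < toℕ y → SortedLine x y
  sortLine< {x} {y} x<y with <-cmp y (x · y)
  ... | tri< y<xy _ _ = sortedLine x y x<y y<xy ≐-refl
  ... | tri≈ _ y≡xy _ = ⊥-elim (·-≢ʳ (<⇒≢ x<y) (sym y≡xy))
  ... | tri> _ _ xy<y with <-cmp x (x · y)
  ...   | tri< x<xy _ _ = sortedLine x (x · y) x<xy (subst ((toℕ (x · y) <_) ∘ toℕ) (sym (cancel x y)) xy<y)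
                            (line-≐ (inj₁ refl) (inj₂ (inj₂ refl)) (<⇒≢ x<xy))
  ...   | tri≈ _ x≡xy _ = ⊥-elim (·-≢ˡ (<⇒≢ x<y) (sym x≡xy))
  ...   | tri> _ _ xy<x = sortedLine (x · y) x xy<x (subst ((toℕ x <_) ∘ toℕ) (sym (cancel′ x y)) x<y)
                            (line-≐ (inj₂ (inj₂ refl)) (inj₁ refl) (<⇒≢ xy<x))

  sortLine : ∀ {x y} → x ≢ y → SortedLine x y
  sortLine {x} {y} x≢y with <-cmp x y
  ... | tri< x<y _ _ = sortLine< x<y
  ... | tri≈ _ x≡y _ = ⊥-elim (x≢y x≡y)
  ... | tri> _ _ y<x = sortedLine low middle low<middle middle<third
                         (≐-trans ≐xy (line-≐ (inj₂ (inj₁ refl)) (inj₁ refl) (x≢y ∘ sym)))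
    where open SortedLine (sortLine< y<x)

  lineBlock : Fin v × Fin v → Maybe (Block v)
  lineBlock (a , b) with a <? b | b <? a · b
  ... | yes a<b | yes b<ab = just (blk a b (a · b) a<b b<ab)
  ... | _       | _        = nothing

  lineBlock-sorted : ∀ {a b} (a<b : toℕ a < toℕ b) (b<ab : toℕ b < toℕ (a · b)) →
                     lineBlock (a , b) ≡ just (blk a b (a · b) a<b b<ab)
  lineBlock-sorted {a} {b} a<b b<ab with a <? b | b <? a · b
  ... | yes a<b′ | yes b<ab′ = cong₂ (λ p q → just (blk a b (a · b) p q)) (<-irrelevant a<b′ a<b) (<-irrelevant b<ab′ b<ab)
  ... | yes _    | no ¬b<ab  = ⊥-elim (¬b<ab b<ab)
  ... | no ¬a<b  | _         = ⊥-elim (¬a<b a<b)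

  lineBlock-line : ∀ p {B} → lineBlock p ≡ just B → c B ≡ a B · b B
  lineBlock-line (a , b) eq with a <? b | b <? a · b
  lineBlock-line (a , b) refl | yes _ | yes _ = refl

  lineBlock-any : ∀ {P : Block v → Set} a b → MaybeAny.Any P (lineBlock (a , b)) →
                  Σ (toℕ a < toℕ b) λ a<b → Σ (toℕ b < toℕ (a · b)) λ b<ab → P (blk a b (a · b) a<b b<ab)
  lineBlock-any a b any with a <? b | b <? a · b
  lineBlock-any a b (just p) | yes a<b | yes b<ab = a<b , b<ab , p

  pairs : List (Fin v × Fin v)
  pairs = cartesianProduct (allFin v) (allFin v)

  ∈-pairs : ∀ a b → (a , b) ∈ₗ pairs
  ∈-pairs a b = ∈-cartesianProduct⁺ (∈-allFin a) (∈-allFin b)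

  blocks : List (Block v)
  blocks = mapMaybe lineBlock pairs

  ∈-blocks⁻ : ∀ {B} → B ∈ₗ blocks → c B ≡ a B · b B
  ∈-blocks⁻ B∈ = let p , eq = ∈-mapMaybe⁻ lineBlock pairs B∈ in lineBlock-line p eq

  ∈-blocks⁺ : ∀ {a b} (a<b : toℕ a < toℕ b) (b<ab : toℕ b < toℕ (a · b)) → blk a b (a · b) a<b b<ab ∈ₗ blocks
  ∈-blocks⁺ {a} {b} a<b b<ab = ∈-mapMaybe⁺ lineBlock (∈-pairs a b) (lineBlock-sorted a<b b<ab)

  blocks-isSTS : IsSTS v blocks
  blocks-isSTS x y x≢y = begin
    pairCount blocks x y                                  ≡⟨ length-filter-mapMaybe lineBlock P? pairs ⟩
    length (filter (MaybeAny.dec P? ∘ lineBlock) pairs)   ≡⟨ length-filter-unique (MaybeAny.dec P? ∘ lineBlock)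
                                                               (cartesianProduct⁺ (allFin⁺ v) (allFin⁺ v))
                                                               (∈-pairs low middle) onLine onlyLine ⟩
    1                                                     ∎
    where
    open ≡-Reasoning
    open SortedLine (sortLine x≢y)
    P : Block v → Set
    P B = x ∈B B × y ∈B B
    P? : ∀ B → Dec (P B)
    P? B = (x ∈B? B) ×-dec (y ∈B? B)
    onLine : MaybeAny.Any P (lineBlock (low , middle))
    onLine rewrite lineBlock-sorted low<middle middle<third =
      just (Equivalence.from ≐xy (inj₁ refl) , Equivalence.from ≐xy (inj₂ (inj₁ refl)))
    onlyLine : ∀ {p} → MaybeAny.Any P (lineBlock p) → p ≡ (low , middle)
    onlyLine {a′ , b′} any with lineBlock-any a′ b′ any
    ... | a′<b′ , b′<a′b′ , x∈ , y∈ =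
      let a′≡low , b′≡middle = ≐-sorted⇒≡ a′<b′ b′<a′b′ low<middle middle<third
                                 (≐-trans (≐-sym (line-≐ x∈ y∈ x≢y)) (≐-sym ≐xy))
      in cong₂ _,_ a′≡low b′≡middle

  blocks-maximalIndependent : ∀ {σ} → IsCompleteCap (λ _ → ⊤) _·_ σ → MaximalIndependent blocks (tabulate σ)
  blocks-maximalIndependent {σ} completeCap = independent , maximal
    where
    open IsCompleteCap completeCap
    open Equivalence
    S = tabulate σ
    independent : Independent blocks S
    independent B B∈ (a∈ , b∈ , c∈)
      with trans (sym (to ∈-tabulate (subst (_∈ S) (∈-blocks⁻ B∈) c∈)))
                 (cap tt tt (<⇒≢ (a<b B)) (to ∈-tabulate a∈) (to ∈-tabulate b∈))
    ... | ()
    maximal : ∀ T → S ⊂ T → ¬ Independent blocks T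
    maximal T (S⊆T , z , z∈T , z∉S) independentT with complete tt (¬-not (z∉S ∘ from ∈-tabulate))
    ... | x , y , _ , _ , x≢y , σx , σy , refl = independentT _ (∈-blocks⁺ low<middle middle<third)
          (∈T (inj₁ refl) , ∈T (inj₂ (inj₁ refl)) , ∈T (inj₂ (inj₂ refl)))
      where
      open SortedLine (sortLine x≢y)
      ∈T : ∀ {u} → u ∈³ line low middle → u ∈ T
      ∈T u∈ with to ≐xy u∈
      ... | inj₁ refl        = S⊆T (from ∈-tabulate σx)
      ... | inj₂ (inj₁ refl) = S⊆T (from ∈-tabulate σy)
      ... | inj₂ (inj₂ refl) = z∈T

record Encoding (B : Set) {A : Set} (V : A → Set) : Set where
  field
    encode        : B → A
    decode        : A → B
    encode-V      : ∀ i → V (encode i)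
    decode-encode : ∀ i → decode (encode i) ≡ i
    encode-decode : ∀ {x} → V x → encode (decode x) ≡ x

  encode-injective : ∀ {i j} → encode i ≡ encode j → i ≡ j
  encode-injective {i} {j} eq = trans (sym (decode-encode i)) (trans (cong decode eq) (decode-encode j))

module Transport {A : Set} {V : A → Set} {_·_ : A → A → A} (sq : IsSteinerQuasigroupOn V _·_)
                 {B : Set} (code : Encoding B V) where
  open IsSteinerQuasigroupOn sq
  open Encoding code

  _∙_ : B → B → B
  i ∙ j = decode (encode i · encode j)

  encode-∙ : ∀ i j → encode (i ∙ j) ≡ encode i · encode j
  encode-∙ i j = encode-decode (closed (encode-V i) (encode-V j))

  isSteinerQuasigroup : IsSteinerQuasigroup _∙_
  isSteinerQuasigroup = record
    { idem   = λ i → trans (cong decode (idem (encode-V i))) (decode-encode i)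
    ; comm   = λ i j → cong decode (comm (encode-V i) (encode-V j))
    ; cancel = λ i j → begin
        decode (encode i · encode (i ∙ j))         ≡⟨ cong (λ x → decode (encode i · x)) (encode-∙ i j) ⟩
        decode (encode i · (encode i · encode j))  ≡⟨ cong decode (cancel (encode-V i) (encode-V j)) ⟩
        decode (encode j)                          ≡⟨ decode-encode j ⟩
        j                                          ∎
    }
    where open ≡-Reasoning

  isCompleteCap : ∀ {σ} → IsCompleteCap V _·_ σ → IsCompleteCap (λ _ → ⊤) _∙_ (σ ∘ encode)
  isCompleteCap {σ} completeCap = record
    { cap = λ {i} {j} _ _ i≢j σi σj →
        trans (cong σ (encode-∙ i j)) (cap (encode-V i) (encode-V j) (i≢j ∘ encode-injective) σi σj)
    ; complete = λ {z} _ σz →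
        let x , y , Vx , Vy , x≢y , σx , σy , xy≡z = complete (encode-V z) σz
        in decode x , decode y , tt , tt , x≢y ∘ decode-injective Vx Vy ,
           trans (cong σ (encode-decode Vx)) σx , trans (cong σ (encode-decode Vy)) σy ,
           trans (cong decode (cong₂ _·_ (encode-decode Vx) (encode-decode Vy)))
                 (trans (cong decode xy≡z) (decode-encode z))
    }
    where
    open IsCompleteCap completeCap
    decode-injective : ∀ {x y} → V x → V y → decode x ≡ decode y → x ≡ y
    decode-injective Vx Vy eq = trans (sym (encode-decode Vx)) (trans (cong encode eq) (encode-decode Vy))

_·₃_ : Fin 3 → Fin 3 → Fin 3
0F ·₃ 0F = 0F
0F ·₃ 1F = 2F
0F ·₃ 2F = 1F
1F ·₃ 0F = 2F
1F ·₃ 1F = 1F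
1F ·₃ 2F = 0F
2F ·₃ 0F = 1F
2F ·₃ 1F = 0F
2F ·₃ 2F = 2F

·₃-isSteinerQuasigroup : IsSteinerQuasigroup _·₃_
·₃-isSteinerQuasigroup = record { idem = idem ; comm = comm ; cancel = cancel }
  where
  idem : ∀ x → x ·₃ x ≡ x
  idem 0F = refl
  idem 1F = refl
  idem 2F = refl
  comm : ∀ x y → x ·₃ y ≡ y ·₃ x
  comm 0F 0F = refl
  comm 0F 1F = refl
  comm 0F 2F = refl
  comm 1F 0F = refl
  comm 1F 1F = refl
  comm 1F 2F = refl
  comm 2F 0F = refl
  comm 2F 1F = refl
  comm 2F 2F = refl
  cancel : ∀ x y → x ·₃ (x ·₃ y) ≡ y
  cancel 0F 0F = refl
  cancel 0F 1F = refl
  cancel 0F 2F = refl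
  cancel 1F 0F = refl
  cancel 1F 1F = refl
  cancel 1F 2F = refl
  cancel 2F 0F = refl
  cancel 2F 1F = refl
  cancel 2F 2F = refl

module _ {_·₁_ : A → A → A} {_·₂_ : B → B → B} where

  _×-·_ : A × B → A × B → A × B
  (x₁ , x₂) ×-· (y₁ , y₂) = x₁ ·₁ y₁ , x₂ ·₂ y₂

  ×-isSteinerQuasigroup : IsSteinerQuasigroup _·₁_ → IsSteinerQuasigroup _·₂_ → IsSteinerQuasigroup _×-·_
  ×-isSteinerQuasigroup sq₁ sq₂ = record
    { idem   = λ (x₁ , x₂) → cong₂ _,_ (Q₁.idem x₁) (Q₂.idem x₂)
    ; comm   = λ (x₁ , x₂) (y₁ , y₂) → cong₂ _,_ (Q₁.comm x₁ y₁) (Q₂.comm x₂ y₂)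
    ; cancel = λ (x₁ , x₂) (y₁ , y₂) → cong₂ _,_ (Q₁.cancel x₁ y₁) (Q₂.cancel x₂ y₂)
    }
    where
    module Q₁ = IsSteinerQuasigroup sq₁
    module Q₂ = IsSteinerQuasigroup sq₂

-- The marked points (first bit true) go to the four non-zero points on the two axes of
-- AG(2,3) = 𝔽₃², a complete cap avoiding the origin, and nothing goes to the origin.
planePoint : Maybe (Vec Bool 3) → Fin 3 × Fin 3
planePoint nothing                        = 0F , 0F
planePoint (just (false ∷ b ∷ c ∷ []))    = nonzero b , nonzero c
  where
  nonzero : Bool → Fin 3
  nonzero false = 1F
  nonzero true  = 2F
planePoint (just (true ∷ false ∷ false ∷ [])) = 1F , 0F
planePoint (just (true ∷ false ∷ true ∷ []))  = 2F , 0F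
planePoint (just (true ∷ true ∷ false ∷ []))  = 0F , 1F
planePoint (just (true ∷ true ∷ true ∷ []))   = 0F , 2F

fromPlane : Fin 3 × Fin 3 → Maybe (Vec Bool 3)
fromPlane (0F , 0F) = nothing
fromPlane (1F , 0F) = just (true ∷ false ∷ false ∷ [])
fromPlane (2F , 0F) = just (true ∷ false ∷ true ∷ [])
fromPlane (0F , 1F) = just (true ∷ true ∷ false ∷ [])
fromPlane (0F , 2F) = just (true ∷ true ∷ true ∷ [])
fromPlane (1F , 1F) = just (false ∷ false ∷ false ∷ [])
fromPlane (1F , 2F) = just (false ∷ false ∷ true ∷ [])
fromPlane (2F , 1F) = just (false ∷ true ∷ false ∷ [])
fromPlane (2F , 2F) = just (false ∷ true ∷ true ∷ [])

planeEncoding : Encoding (Maybe (Vec Bool 3)) {Fin 3 × Fin 3} (λ _ → ⊤)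
planeEncoding = record
  { encode = planePoint ; decode = fromPlane ; encode-V = λ _ → tt
  ; decode-encode = decode-encode ; encode-decode = λ {x} _ → encode-decode x }
  where
  decode-encode : ∀ x → fromPlane (planePoint x) ≡ x
  decode-encode nothing                             = refl
  decode-encode (just (false ∷ false ∷ false ∷ [])) = refl
  decode-encode (just (false ∷ false ∷ true ∷ []))  = refl
  decode-encode (just (false ∷ true ∷ false ∷ []))  = refl
  decode-encode (just (false ∷ true ∷ true ∷ []))   = refl
  decode-encode (just (true ∷ false ∷ false ∷ []))  = refl
  decode-encode (just (true ∷ false ∷ true ∷ []))   = refl
  decode-encode (just (true ∷ true ∷ false ∷ []))   = refl
  decode-encode (just (true ∷ true ∷ true ∷ []))    = refl
  encode-decode : ∀ p → planePoint (fromPlane p) ≡ p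
  encode-decode (0F , 0F) = refl
  encode-decode (1F , 0F) = refl
  encode-decode (2F , 0F) = refl
  encode-decode (0F , 1F) = refl
  encode-decode (0F , 2F) = refl
  encode-decode (1F , 1F) = refl
  encode-decode (1F , 2F) = refl
  encode-decode (2F , 1F) = refl
  encode-decode (2F , 2F) = refl

module AffinePlane = Transport
  (IsSteinerQuasigroup.isSteinerQuasigroupOn (×-isSteinerQuasigroup ·₃-isSteinerQuasigroup ·₃-isSteinerQuasigroup))
  planeEncoding

_·₉_ : Maybe (Vec Bool 3) → Maybe (Vec Bool 3) → Maybe (Vec Bool 3)
_·₉_ = AffinePlane._∙_

marked : ∀ {m} → Maybe (Vec Bool (suc m)) → Bool
marked nothing        = false
marked (just (b ∷ _)) = b

·₉-isCompleteCap : IsCompleteCap (λ _ → ⊤) _·₉_ marked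
·₉-isCompleteCap = record { cap = λ _ _ → cap ; complete = λ _ → complete }
  where
  cap : ∀ {x y} → x ≢ y → marked x ≡ true → marked y ≡ true → marked (x ·₉ y) ≡ false
  cap {just (true ∷ false ∷ false ∷ [])} {just (true ∷ false ∷ false ∷ [])} x≢y _ _ = ⊥-elim (x≢y refl)
  cap {just (true ∷ false ∷ false ∷ [])} {just (true ∷ false ∷ true ∷ [])}  _   _ _ = refl
  cap {just (true ∷ false ∷ false ∷ [])} {just (true ∷ true ∷ false ∷ [])}  _   _ _ = refl
  cap {just (true ∷ false ∷ false ∷ [])} {just (true ∷ true ∷ true ∷ [])}   _   _ _ = refl
  cap {just (true ∷ false ∷ true ∷ [])}  {just (true ∷ false ∷ false ∷ [])} _   _ _ = refl
  cap {just (true ∷ false ∷ true ∷ [])}  {just (true ∷ false ∷ true ∷ [])}  x≢y _ _ = ⊥-elim (x≢y refl)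
  cap {just (true ∷ false ∷ true ∷ [])}  {just (true ∷ true ∷ false ∷ [])}  _   _ _ = refl
  cap {just (true ∷ false ∷ true ∷ [])}  {just (true ∷ true ∷ true ∷ [])}   _   _ _ = refl
  cap {just (true ∷ true ∷ false ∷ [])}  {just (true ∷ false ∷ false ∷ [])} _   _ _ = refl
  cap {just (true ∷ true ∷ false ∷ [])}  {just (true ∷ false ∷ true ∷ [])}  _   _ _ = refl
  cap {just (true ∷ true ∷ false ∷ [])}  {just (true ∷ true ∷ false ∷ [])}  x≢y _ _ = ⊥-elim (x≢y refl)
  cap {just (true ∷ true ∷ false ∷ [])}  {just (true ∷ true ∷ true ∷ [])}   _   _ _ = refl
  cap {just (true ∷ true ∷ true ∷ [])}   {just (true ∷ false ∷ false ∷ [])} _   _ _ = refl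
  cap {just (true ∷ true ∷ true ∷ [])}   {just (true ∷ false ∷ true ∷ [])}  _   _ _ = refl
  cap {just (true ∷ true ∷ true ∷ [])}   {just (true ∷ true ∷ false ∷ [])}  _   _ _ = refl
  cap {just (true ∷ true ∷ true ∷ [])}   {just (true ∷ true ∷ true ∷ [])}   x≢y _ _ = ⊥-elim (x≢y refl)

  complete : ∀ {z} → marked z ≡ false →
             ∃₂ λ x y → ⊤ × ⊤ × x ≢ y × marked x ≡ true × marked y ≡ true × x ·₉ y ≡ z
  complete {nothing} _ =
    just (true ∷ false ∷ false ∷ []) , just (true ∷ false ∷ true ∷ []) , tt , tt , (λ ()) , refl , refl , refl
  complete {just (false ∷ b ∷ c ∷ [])} _ =
    just (true ∷ false ∷ not b ∷ []) , just (true ∷ true ∷ not c ∷ []) , tt , tt , (λ ()) , refl , refl , third b c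
    where
    third : ∀ b c → just (true ∷ false ∷ not b ∷ []) ·₉ just (true ∷ true ∷ not c ∷ []) ≡ just (false ∷ b ∷ c ∷ [])
    third false false = refl
    third false true  = refl
    third true  false = refl
    third true  true  = refl

module _ {n : ℕ} where

  zeros : Vec Bool n
  zeros = replicate n false

  infixl 6 _⊕_
  _⊕_ : Vec Bool n → Vec Bool n → Vec Bool n
  _⊕_ = zipWith _xor_

  ⊕-comm : ∀ x y → x ⊕ y ≡ y ⊕ x
  ⊕-comm = zipWith-comm xor-comm

  ⊕-identityʳ : ∀ x → x ⊕ zeros ≡ x
  ⊕-identityʳ = zipWith-identityʳ xor-identityʳ

  _≟_ : (x y : Vec Bool n) → Dec (x ≡ y)
  _≟_ = ≡-dec _≟ᵇ_

⊕-self : ∀ {n} (x : Vec Bool n) → x ⊕ x ≡ zeros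
⊕-self []       = refl
⊕-self (b ∷ x) = cong₂ _∷_ (xor-same b) (⊕-self x)

⊕-cancel : ∀ {n} (x y : Vec Bool n) → x ⊕ (x ⊕ y) ≡ y
⊕-cancel []       []       = refl
⊕-cancel (b ∷ x) (c ∷ y) = cong₂ _∷_ (trans (sym (xor-assoc b b c)) (cong (_xor c) (xor-same b))) (⊕-cancel x y)

⊕-≡ˡ : ∀ {n} {x y : Vec Bool n} → x ⊕ y ≡ x → y ≡ zeros
⊕-≡ˡ {x = x} {y} eq = trans (sym (⊕-cancel x y)) (trans (cong (x ⊕_) eq) (⊕-self x))

⊕-≡zeros : ∀ {n} {x y : Vec Bool n} → x ⊕ y ≡ zeros → x ≡ y
⊕-≡zeros {x = x} {y} eq = trans (sym (⊕-identityʳ x)) (trans (cong (x ⊕_) (sym eq)) (⊕-cancel x y))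

module _ {m k : ℕ} where

  Point : Set
  Point = Maybe (Vec Bool m × Vec Bool k)

  Valid : Point → Set
  Valid nothing        = ⊤
  Valid (just (_ , h)) = h ≢ zeros

  forget : Point → Maybe (Vec Bool m)
  forget = Maybe.map proj₁

module Product {m k : ℕ} {_⋆_ : Maybe (Vec Bool (suc m)) → Maybe (Vec Bool (suc m)) → Maybe (Vec Bool (suc m))}
               (fibre : IsSteinerQuasigroup _⋆_) (fibreCap : IsCompleteCap (λ _ → ⊤) _⋆_ marked) where

  private
    G = Vec Bool (suc m)
    H = Vec Bool k
    module F = IsSteinerQuasigroup fibre

  InFibre : H → Point {suc m} {k} → Set
  InFibre h = All ((_≡ h) ∘ proj₂)

  inFibre : H → Maybe G → Point {suc m} {k}
  inFibre h = Maybe.map (_, h)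

  _·_ : Point {suc m} {k} → Point → Point
  nothing ·  nothing               = nothing
  nothing ·  just (r′ , h′)        = inFibre h′ (nothing ⋆ just r′)
  just (r , h) · nothing           = inFibre h (just r ⋆ nothing)
  just (r , h) · just (r′ , h′) with h ≟ h′
  ... | yes _ = inFibre h (just r ⋆ just r′)
  ... | no _  = just (r ⊕ r′ , h ⊕ h′)

  inFibre-InFibre : ∀ h p → InFibre h (inFibre h p)
  inFibre-InFibre h nothing  = nothing
  inFibre-InFibre h (just _) = just refl

  forget-inFibre : ∀ h p → forget (inFibre h p) ≡ p
  forget-inFibre h nothing  = refl
  forget-inFibre h (just _) = refl

  inFibre-forget : ∀ {h x} → InFibre h x → inFibre h (forget x) ≡ x
  inFibre-forget nothing     = refl
  inFibre-forget (just refl) = refl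

  inFibre-Valid : ∀ {h} → h ≢ zeros → ∀ p → Valid (inFibre h p)
  inFibre-Valid h≢0 nothing  = tt
  inFibre-Valid h≢0 (just _) = h≢0

  inFibre-injective : ∀ {h p q} → inFibre h p ≡ inFibre h q → p ≡ q
  inFibre-injective {h} {p} {q} eq = trans (sym (forget-inFibre h p)) (trans (cong forget eq) (forget-inFibre h q))

  ·-inFibre : ∀ {h x y} → InFibre h x → InFibre h y → x · y ≡ inFibre h (forget x ⋆ forget y)
  ·-inFibre {h} nothing nothing = cong (inFibre h) (sym (F.idem nothing))
  ·-inFibre nothing (just refl) = refl
  ·-inFibre (just refl) nothing = refl
  ·-inFibre {h} {just (r , _)} {just (r′ , _)} (just refl) (just refl) with h ≟ h
  ... | yes _  = refl
  ... | no h≢h = ⊥-elim (h≢h refl)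

  ·-apart : ∀ {r r′ h h′} → h ≢ h′ → just (r , h) · just (r′ , h′) ≡ just (r ⊕ r′ , h ⊕ h′)
  ·-apart {h = h} {h′} h≢h′ with h ≟ h′
  ... | yes h≡h′ = ⊥-elim (h≢h′ h≡h′)
  ... | no _     = refl

  data Position : Point {suc m} {k} → Point → Set where
    sameFibre : ∀ {x y} h → InFibre h x → InFibre h y → Position x y
    apart     : ∀ {r r′ h h′} → h ≢ h′ → Position (just (r , h)) (just (r′ , h′))

  position : ∀ x y → Position x y
  position nothing        nothing          = sameFibre zeros nothing nothing
  position nothing        (just (_ , h′))  = sameFibre h′ nothing (just refl)
  position (just (_ , h)) nothing          = sameFibre h (just refl) nothing
  position (just (_ , h)) (just (_ , h′)) with h ≟ h′
  ... | yes refl = sameFibre h (just refl) (just refl)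
  ... | no h≢h′  = apart h≢h′

  isSteinerQuasigroupOn : IsSteinerQuasigroupOn Valid _·_
  isSteinerQuasigroupOn = record { closed = closed ; idem = idem ; comm = comm ; cancel = cancel }
    where
    open ≡-Reasoning

    closed : ∀ {x y} → Valid x → Valid y → Valid (x · y)
    closed {nothing}      {nothing}       _   _    = tt
    closed {nothing}      {just (r′ , _)}  _   h′≢0 = inFibre-Valid h′≢0 (nothing ⋆ just r′)
    closed {just (r , _)} {nothing}        h≢0 _    = inFibre-Valid h≢0 (just r ⋆ nothing)
    closed {just (r , h)} {just (r′ , h′)} h≢0 _ with h ≟ h′
    ... | yes _    = inFibre-Valid h≢0 (just r ⋆ just r′)
    ... | no h≢h′  = h≢h′ ∘ ⊕-≡zeros

    idem : ∀ {x} → Valid x → x · x ≡ x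
    idem {x} _ with position x x
    ... | apart h≢h = ⊥-elim (h≢h refl)
    ... | sameFibre h Fx _ = begin
      x · x                             ≡⟨ ·-inFibre Fx Fx ⟩
      inFibre h (forget x ⋆ forget x)   ≡⟨ cong (inFibre h) (F.idem (forget x)) ⟩
      inFibre h (forget x)              ≡⟨ inFibre-forget Fx ⟩
      x                                 ∎

    comm : ∀ {x y} → Valid x → Valid y → x · y ≡ y · x
    comm {x} {y} _ _ with position x y
    ... | sameFibre h Fx Fy = begin
      x · y                             ≡⟨ ·-inFibre Fx Fy ⟩
      inFibre h (forget x ⋆ forget y)   ≡⟨ cong (inFibre h) (F.comm (forget x) (forget y)) ⟩
      inFibre h (forget y ⋆ forget x)   ≡⟨ ·-inFibre Fy Fx ⟨
      y · x                             ∎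
    ... | apart {r} {r′} {h} {h′} h≢h′ = begin
      x · y                             ≡⟨ ·-apart h≢h′ ⟩
      just (r ⊕ r′ , h ⊕ h′)            ≡⟨ cong₂ (λ s t → just (s , t)) (⊕-comm r r′) (⊕-comm h h′) ⟩
      just (r′ ⊕ r , h′ ⊕ h)            ≡⟨ ·-apart (h≢h′ ∘ sym) ⟨
      y · x                             ∎

    cancel : ∀ {x y} → Valid x → Valid y → x · (x · y) ≡ y
    cancel {x} {y} _ Vy with position x y
    ... | sameFibre h Fx Fy = begin
      x · (x · y)                                     ≡⟨ cong (x ·_) (·-inFibre Fx Fy) ⟩
      x · inFibre h (forget x ⋆ forget y)             ≡⟨ ·-inFibre Fx (inFibre-InFibre h (forget x ⋆ forget y)) ⟩
      inFibre h (forget x ⋆ forget (inFibre h (forget x ⋆ forget y)))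
                                                      ≡⟨ cong (λ p → inFibre h (forget x ⋆ p)) (forget-inFibre h _) ⟩
      inFibre h (forget x ⋆ (forget x ⋆ forget y))    ≡⟨ cong (inFibre h) (F.cancel (forget x) (forget y)) ⟩
      inFibre h (forget y)                            ≡⟨ inFibre-forget Fy ⟩
      y                                               ∎
    ... | apart {r} {r′} {h} {h′} h≢h′ = begin
      x · (x · y)                                     ≡⟨ cong (x ·_) (·-apart h≢h′) ⟩
      just (r , h) · just (r ⊕ r′ , h ⊕ h′)           ≡⟨ ·-apart (Vy ∘ ⊕-≡ˡ ∘ sym) ⟩
      just (r ⊕ (r ⊕ r′) , h ⊕ (h ⊕ h′))              ≡⟨ cong₂ (λ s t → just (s , t)) (⊕-cancel r r′) (⊕-cancel h h′) ⟩
      y                                               ∎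

  -- h₀ is the fibre in which ∞ is exhibited as the product of two marked points.
  isCompleteCap : ∀ {h₀ : H} → h₀ ≢ zeros → IsCompleteCap Valid _·_ (marked ∘ forget)
  isCompleteCap h₀≢0 = record { cap = cap ; complete = complete }
    where
    open ≡-Reasoning
    module FC = IsCompleteCap fibreCap

    cap : ∀ {x y} → Valid x → Valid y → x ≢ y → marked (forget x) ≡ true → marked (forget y) ≡ true →
          marked (forget (x · y)) ≡ false
    cap {x} {y} _ _ x≢y σx σy with position x y
    ... | sameFibre h Fx Fy = begin
      marked (forget (x · y))                             ≡⟨ cong (marked ∘ forget) (·-inFibre Fx Fy) ⟩
      marked (forget (inFibre h (forget x ⋆ forget y)))   ≡⟨ cong marked (forget-inFibre h (forget x ⋆ forget y)) ⟩
      marked (forget x ⋆ forget y)                        ≡⟨ FC.cap tt tt (x≢y ∘ forget-injective) σx σy ⟩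
      false                                               ∎
      where
      forget-injective : forget x ≡ forget y → x ≡ y
      forget-injective eq = trans (sym (inFibre-forget Fx)) (trans (cong (inFibre h) eq) (inFibre-forget Fy))
    ... | apart {_ ∷ _} {_ ∷ _} h≢h′ = trans (cong (marked ∘ forget) (·-apart h≢h′)) (cong₂ _xor_ σx σy)

    completeIn : ∀ {h z} → h ≢ zeros → InFibre h z → marked (forget z) ≡ false →
                 ∃₂ λ x y → Valid x × Valid y × x ≢ y × marked (forget x) ≡ true × marked (forget y) ≡ true × x · y ≡ z
    completeIn {h} {z} h≢0 Fz σz with FC.complete {forget z} tt σz
    ... | p , q , _ , _ , p≢q , σp , σq , pq≡z =
      inFibre h p , inFibre h q , inFibre-Valid h≢0 p , inFibre-Valid h≢0 q , p≢q ∘ inFibre-injective ,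
      trans (cong marked (forget-inFibre h p)) σp , trans (cong marked (forget-inFibre h q)) σq , (begin
        inFibre h p · inFibre h q                                     ≡⟨ ·-inFibre (inFibre-InFibre h p) (inFibre-InFibre h q) ⟩
        inFibre h (forget (inFibre h p) ⋆ forget (inFibre h q))       ≡⟨ cong (inFibre h) (cong₂ _⋆_ (forget-inFibre h p) (forget-inFibre h q)) ⟩
        inFibre h (p ⋆ q)                                             ≡⟨ cong (inFibre h) pq≡z ⟩
        inFibre h (forget z)                                          ≡⟨ inFibre-forget Fz ⟩
        z                                                             ∎)

    complete : ∀ {z} → Valid z → marked (forget z) ≡ false →
               ∃₂ λ x y → Valid x × Valid y × x ≢ y × marked (forget x) ≡ true × marked (forget y) ≡ true × x · y ≡ z
    complete {nothing}      _   = completeIn h₀≢0 nothing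
    complete {just (_ , _)} h≢0 = completeIn h≢0 (just refl)

bit : Bool → ℕ
bit false = 0
bit true  = 1

lowBit : ℕ → Bool
lowBit zero          = false
lowBit (suc zero)    = true
lowBit (suc (suc n)) = lowBit n

fromBits : ∀ {n} → Vec Bool n → ℕ
fromBits []      = 0
fromBits (b ∷ w) = bit b + 2 * fromBits w

toBits : ∀ n → ℕ → Vec Bool n
toBits zero    _ = []
toBits (suc n) x = lowBit x ∷ toBits n ⌊ x /2⌋

+2*suc : ∀ b y → b + 2 * suc y ≡ suc (suc (b + 2 * y))
+2*suc = solve-∀

bit-lowBit : ∀ x → bit (lowBit x) + 2 * ⌊ x /2⌋ ≡ x
bit-lowBit zero          = refl
bit-lowBit (suc zero)    = refl
bit-lowBit (suc (suc x)) = trans (+2*suc (bit (lowBit x)) ⌊ x /2⌋) (cong (suc ∘ suc) (bit-lowBit x))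

lowBit-bit : ∀ b y → lowBit (bit b + 2 * y) ≡ b
lowBit-bit false zero    = refl
lowBit-bit true  zero    = refl
lowBit-bit b     (suc y) rewrite +2*suc (bit b) y = lowBit-bit b y

⌊bit/2⌋ : ∀ b y → ⌊ bit b + 2 * y /2⌋ ≡ y
⌊bit/2⌋ false zero    = refl
⌊bit/2⌋ true  zero    = refl
⌊bit/2⌋ b     (suc y) rewrite +2*suc (bit b) y = cong suc (⌊bit/2⌋ b y)

toBits-fromBits : ∀ {n} (w : Vec Bool n) → toBits n (fromBits w) ≡ w
toBits-fromBits []      = refl
toBits-fromBits (b ∷ w) = cong₂ _∷_ (lowBit-bit b (fromBits w))
                                    (trans (cong (toBits _) (⌊bit/2⌋ b (fromBits w))) (toBits-fromBits w))

fromBits-toBits : ∀ n {x} → x < 2 ^ n → fromBits (toBits n x) ≡ x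
fromBits-toBits zero    {zero}  _         = refl
fromBits-toBits zero    {suc _} (s≤s ())
fromBits-toBits (suc n) {x} x<2^[1+n] = trans (cong (λ y → bit (lowBit x) + 2 * y) (fromBits-toBits n ⌊x/2⌋<2^n))
                                              (bit-lowBit x)
  where
  ⌊x/2⌋<2^n : ⌊ x /2⌋ < 2 ^ n
  ⌊x/2⌋<2^n = *-cancelˡ-< 2 ⌊ x /2⌋ (2 ^ n)
    (≤-<-trans (subst (2 * ⌊ x /2⌋ ≤_) (bit-lowBit x) (m≤n+m (2 * ⌊ x /2⌋) (bit (lowBit x)))) x<2^[1+n])

fromBits<2^n : ∀ {n} (w : Vec Bool n) → fromBits w < 2 ^ n
fromBits<2^n []              = s≤s z≤n
fromBits<2^n {suc n} (b ∷ w) = begin-strict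
  bit b + 2 * fromBits w  ≤⟨ +-monoˡ-≤ _ (bit≤1 b) ⟩
  1 + 2 * fromBits w      <⟨ n<1+n _ ⟩
  2 + 2 * fromBits w      ≡⟨ +2*suc 0 (fromBits w) ⟨
  2 * suc (fromBits w)    ≤⟨ *-monoʳ-≤ 2 (fromBits<2^n w) ⟩
  2 * 2 ^ n               ∎
  where
  open ≤-Reasoning
  bit≤1 : ∀ b → bit b ≤ 1
  bit≤1 false = z≤n
  bit≤1 true  = s≤s z≤n

fromBits-++ : ∀ {m n} (r : Vec Bool m) (h : Vec Bool n) → fromBits (r ++ h) ≡ fromBits r + 2 ^ m * fromBits h
fromBits-++ []      h = sym (+-identityʳ (fromBits h))
fromBits-++ {suc m} (b ∷ r) h = trans (cong (λ y → bit b + 2 * y) (fromBits-++ r h))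
                                      (lemma (bit b) (fromBits r) (2 ^ m) (fromBits h))
  where
  lemma : ∀ b x p y → b + 2 * (x + p * y) ≡ (b + 2 * x) + (2 * p) * y
  lemma = solve-∀

fromBits-zeros : ∀ n → fromBits (zeros {n}) ≡ 0
fromBits-zeros zero    = refl
fromBits-zeros (suc n) = cong (2 *_) (fromBits-zeros n)

fromBits≡0 : ∀ {n} (w : Vec Bool n) → fromBits w ≡ 0 → w ≡ zeros
fromBits≡0 []          _  = refl
fromBits≡0 (true ∷ w)  ()
fromBits≡0 (false ∷ w) eq = cong (false ∷_) (fromBits≡0 w (m+n≡0⇒m≡0 (fromBits w) eq))

∣tabulate-lowBit∣ : ∀ n → ∣ tabulate {n = n} (lowBit ∘ toℕ) ∣ ≡ ⌊ n /2⌋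
∣tabulate-lowBit∣ zero          = refl
∣tabulate-lowBit∣ (suc zero)    = refl
∣tabulate-lowBit∣ (suc (suc n)) = cong suc (∣tabulate-lowBit∣ n)

-- Index 0 is ∞ and index x + 1 is the point (r , h) whose bits r ++ h spell 8 + x; so h ≠ 0
-- exactly when the number is at least 8, and the first bit of r is the parity of x, which makes
-- the count of marked indices a definitional instance of ∣tabulate-lowBit∣.
module BinaryEncoding {k D : ℕ} (size : 8 + D ≡ 2 ^ (3 + k)) where

  split : Vec Bool (3 + k) → Vec Bool 3 × Vec Bool k
  split (a ∷ b ∷ c ∷ h) = a ∷ b ∷ c ∷ [] , h

  split-++ : ∀ r h → split (r ++ h) ≡ (r , h)
  split-++ (a ∷ b ∷ c ∷ []) h = refl

  ++-split : ∀ w → uncurry _++_ (split w) ≡ w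
  ++-split (a ∷ b ∷ c ∷ h) = refl

  number : Vec Bool 3 × Vec Bool k → ℕ
  number (r , h) = fromBits (r ++ h)

  pointAt : ℕ → Point {3} {k}
  pointAt zero    = nothing
  pointAt (suc x) = just (split (toBits (3 + k) (8 + x)))

  number-pointAt : ∀ {x} → x < D → number (split (toBits (3 + k) (8 + x))) ≡ 8 + x
  number-pointAt {x} x<D = trans (cong fromBits (++-split (toBits (3 + k) (8 + x))))
                                 (fromBits-toBits (3 + k) (subst (8 + x <_) size (+-monoʳ-< 8 x<D)))

  number-zeros<8 : ∀ r → number (r , zeros) < 8
  number-zeros<8 r = subst (_< 8) (sym (begin
    fromBits (r ++ zeros)               ≡⟨ fromBits-++ r zeros ⟩
    fromBits r + 8 * fromBits (zeros {k}) ≡⟨ cong (λ y → fromBits r + 8 * y) (fromBits-zeros k) ⟩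
    fromBits r + 8 * 0                  ≡⟨ cong (fromBits r +_) (*-zeroʳ 8) ⟩
    fromBits r + 0                      ≡⟨ +-identityʳ (fromBits r) ⟩
    fromBits r                          ∎)) (fromBits<2^n r)
    where open ≡-Reasoning

  8≤number : ∀ {r h} → h ≢ zeros → 8 ≤ number (r , h)
  8≤number {r} {h} h≢0 with fromBits h in eq
  ... | zero  = ⊥-elim (h≢0 (fromBits≡0 h eq))
  ... | suc y = subst (8 ≤_) (sym (trans (fromBits-++ r h) (cong (λ z → fromBits r + 8 * z) eq)))
                      (≤-trans (*-monoʳ-≤ 8 (s≤s (z≤n {y}))) (m≤n+m (8 * suc y) (fromBits r)))

  pointAt-Valid : ∀ {x} → x < D → Valid (pointAt (suc x))
  pointAt-Valid {x} x<D h≡0 = <⇒≱ (number-zeros<8 r) (subst (8 ≤_) 8+x≡ (m≤m+n 8 x))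
    where
    q = split (toBits (3 + k) (8 + x))
    r = proj₁ q
    8+x≡ : 8 + x ≡ number (r , zeros)
    8+x≡ = trans (sym (number-pointAt x<D)) (cong (λ h → number (r , h)) h≡0)

  index : Point → Fin (suc D)
  index nothing  = Fin.zero
  index (just q) = fromℕ< (s≤s (∸-monoˡ-≤ 7 (≤-pred (subst (number q <_) (sym size) (fromBits<2^n (uncurry _++_ q))))))

  encoding : Encoding (Fin (suc D)) (Valid {3} {k})
  encoding = record
    { encode        = pointAt ∘ toℕ
    ; decode        = index
    ; encode-V      = encode-V
    ; decode-encode = decode-encode
    ; encode-decode = encode-decode
    }
    where
    open ≡-Reasoning
    encode-V : ∀ i → Valid (pointAt (toℕ i))
    encode-V Fin.zero    = _
    encode-V (Fin.suc i) = pointAt-Valid (toℕ<n i)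

    decode-encode : ∀ i → index (pointAt (toℕ i)) ≡ i
    decode-encode Fin.zero    = refl
    decode-encode (Fin.suc i) = toℕ-injective (trans (toℕ-fromℕ< _) (cong (_∸ 7) (number-pointAt (toℕ<n i))))

    encode-decode : ∀ {p} → Valid p → pointAt (toℕ (index p)) ≡ p
    encode-decode {nothing}      _   = refl
    encode-decode {just (r , h)} h≢0 = begin
      pointAt (toℕ (index (just (r , h))))          ≡⟨ cong pointAt (toℕ-fromℕ< _) ⟩
      pointAt (number (r , h) ∸ 7)                  ≡⟨ cong (λ n → pointAt (n ∸ 7)) 8+y≡n ⟨
      just (split (toBits (3 + k) (8 + y)))         ≡⟨ cong (λ n → just (split (toBits (3 + k) n))) 8+y≡n ⟩
      just (split (toBits (3 + k) (fromBits (r ++ h)))) ≡⟨ cong (λ w → just (split w)) (toBits-fromBits (r ++ h)) ⟩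
      just (split (r ++ h))                         ≡⟨ cong just (split-++ r h) ⟩
      just (r , h)                                  ∎
      where
      y = number (r , h) ∸ 8
      8+y≡n : 8 + y ≡ number (r , h)
      8+y≡n = m+[n∸m]≡n (8≤number {r} h≢0)

  ∣marked∣ : ∣ tabulate (marked ∘ forget ∘ Encoding.encode encoding) ∣ ≡ ⌊ D /2⌋
  ∣marked∣ = ∣tabulate-lowBit∣ D

STSWithHalfIndependentSet : ℕ → Set
STSWithHalfIndependentSet v =
  Σ (List (Block v)) λ 𝓑 → IsSTS v 𝓑 × Σ (Subset v) λ S → MaximalIndependent 𝓑 S × 2 * ∣ S ∣ ≡ v ∸ 1

⌊2*n/2⌋≡n : ∀ n → ⌊ 2 * n /2⌋ ≡ n
⌊2*n/2⌋≡n zero    = refl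
⌊2*n/2⌋≡n (suc n) = trans (cong ⌊_/2⌋ (+2*suc 0 n)) (cong suc (⌊2*n/2⌋≡n n))

stsWithHalfIndependentSet : ∀ k j → 8 + 8 * j ≡ 2 ^ (3 + suc k) → STSWithHalfIndependentSet (suc (8 * j))
stsWithHalfIndependentSet k j size = blocks , blocks-isSTS , tabulate σ , blocks-maximalIndependent completeCap , halfSize
  where
  open Product {k = suc k} AffinePlane.isSteinerQuasigroup ·₉-isCompleteCap
  open BinaryEncoding {k = suc k} size
  module Enumerated = Transport isSteinerQuasigroupOn encoding
  open SteinerTripleSystem Enumerated.isSteinerQuasigroup
  σ = marked ∘ forget ∘ Encoding.encode encoding
  completeCap = Enumerated.isCompleteCap (isCompleteCap {h₀ = true ∷ zeros} (λ ()))
  halfSize : 2 * ∣ tabulate σ ∣ ≡ 8 * j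
  halfSize = begin
    2 * ∣ tabulate σ ∣    ≡⟨ cong (2 *_) ∣marked∣ ⟩
    2 * ⌊ 8 * j /2⌋       ≡⟨ cong (λ n → 2 * ⌊ n /2⌋) (8*j≡2*[4*j] j) ⟩
    2 * ⌊ 2 * (4 * j) /2⌋ ≡⟨ cong (2 *_) (⌊2*n/2⌋≡n (4 * j)) ⟩
    2 * (4 * j)           ≡⟨ 8*j≡2*[4*j] j ⟨
    8 * j                 ∎
    where
    open ≡-Reasoning
    8*j≡2*[4*j] : ∀ j → 8 * j ≡ 2 * (4 * j)
    8*j≡2*[4*j] = solve-∀

mainTheorem6 : (n : ℕ) → 4 ≤ n →
    Σ (List (Block (2 ^ n ∸ 7))) (λ 𝓑 → IsSTS (2 ^ n ∸ 7) 𝓑 ×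
      Σ (Subset (2 ^ n ∸ 7)) (λ S → MaximalIndependent 𝓑 S ×
        2 * ∣ S ∣ ≡ (2 ^ n ∸ 7) ∸ 1))
mainTheorem6 (suc (suc (suc (suc k)))) (s≤s (s≤s (s≤s (s≤s z≤n)))) =
  subst STSWithHalfIndependentSet (cong (_∸ 7) size) (stsWithHalfIndependentSet k j size)
  where
  j = pred (2 ^ suc k)
  size : 8 + 8 * j ≡ 2 ^ (4 + k)
  size = begin
    8 + 8 * j                ≡⟨ 8+8*j≡8*[1+j] j ⟩
    8 * suc j                ≡⟨ cong (8 *_) (suc-pred (2 ^ suc k) {{m^n≢0 2 (suc k)}}) ⟩
    8 * 2 ^ suc k            ≡⟨ 8*x≡2*[2*[2*x]] (2 ^ suc k) ⟩
    2 ^ (4 + k)              ∎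
    where
    open ≡-Reasoning
    8+8*j≡8*[1+j] : ∀ j → 8 + 8 * j ≡ 8 * suc j
    8+8*j≡8*[1+j] = solve-∀
    8*x≡2*[2*[2*x]] : ∀ x → 8 * x ≡ 2 * (2 * (2 * x))
    8*x≡2*[2*[2*x]] = solve-∀
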